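{- Let $n\ge 2$ and let $G$ be the Cayley graph of the symmetric group $S_n$ with all transpositions as generators (vertex set $S_n$, $x\sim \tau x$ for every transposition $\tau$). Then $\mathrm{Ric}(G)=2$.
   Context: For a graph $G=(V,E)$ (undirected, simple, locally finite, no isolated vertices; $y\sim x$ means adjacency) and $f,g:V\to\mathbb R$ define $\Delta f(x)=\sum_{y\sim x}(f(y)-f(x))$, $\Gamma(f,g)(x)=\frac12\sum_{y\sim x}(f(x)-f(y))(g(x)-g(y))$, $\Gamma(f)=\Gamma(f,f)$, $\Gamma_2(f)=\frac12\Delta\Gamma(f)-\Gamma(f,\Delta f)$. The curvature $\mathrm{Ric}(G)$ is the largest $K\in\mathbb R$ such that $\Gamma_2(f)(x)\ge K\,\Gamma(f)(x)$ for all $f:V\to\mathbb R$ and all $x\in V$.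
   Formalization: The functions f and the constants K in the definition of Ric(G) take values in ℚ instead of ℝ. -}

module Defs where

open import Data.Nat using (ℕ)
open import Data.Fin using (Fin; _≟_; _<?_)
open import Data.Vec using (Vec; lookup; map)
open import Data.List using (List; []; _∷_; allFin; filter; concatMap; mapMaybe) renaming (map to lmap)
open import Data.Bool.ListAction using (all)
open import Data.Product using (_×_; _,_; Σ)
open import Data.Bool using (Bool; T; _∨_; not)
open import Data.Maybe using (Maybe; just; nothing)
open import Relation.Nullary.Decidable using (⌊_⌋; T?)
open import Data.Rational using (ℚ; 0ℚ; _+_; _-_; _*_; ½; _≤_; _<_)
open import Relation.Binary.PropositionalEquality using (_≡_)
open import Relation.Nullary using (¬_; yes; no)

record Graph : Set₁ where
  field
    V    : Set
    nbrs : V → List V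
open Graph public

sumℚ : List ℚ → ℚ
sumℚ []       = 0ℚ
sumℚ (q ∷ qs) = q + sumℚ qs

module _ (G : Graph) where
  Δ : (V G → ℚ) → V G → ℚ
  Δ f x = sumℚ (lmap (λ y → f y - f x) (nbrs G x))

  Γ⟨_,_⟩ : (V G → ℚ) → (V G → ℚ) → V G → ℚ
  Γ⟨ f , g ⟩ x = ½ * sumℚ (lmap (λ y → (f x - f y) * (g x - g y)) (nbrs G x))

  Γ : (V G → ℚ) → V G → ℚ
  Γ f = Γ⟨ f , f ⟩

  Γ₂ : (V G → ℚ) → V G → ℚ
  Γ₂ f x = ½ * Δ (Γ f) x - Γ⟨ f , Δ f ⟩ x

  CurvBound : ℚ → Set
  CurvBound K = ∀ (f : V G → ℚ) (x : V G) → K * Γ f x ≤ Γ₂ f x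

  RicIs : ℚ → Set
  RicIs K = CurvBound K × (∀ K' → K < K' → ¬ CurvBound K')

-- Permutations of Fin n, represented by their value vectors
-- (x as the vector (x 0, …, x (n-1))) together with a (proof-irrelevant,
-- boolean) certificate of injectivity: lookup v i = lookup v j ⇒ i = j.
injᵇ : ∀ {n} → Vec (Fin n) n → Bool
injᵇ {n} v = all (λ i → all (λ j → ⌊ i ≟ j ⌋ ∨ not ⌊ lookup v i ≟ lookup v j ⌋) (allFin n)) (allFin n)

Perm : ℕ → Set
Perm n = Σ (Vec (Fin n) n) (λ v → T (injᵇ v))

swap : ∀ {n} → Fin n → Fin n → Fin n → Fin n
swap i j k with k ≟ i
... | yes _ = j
... | no _ with k ≟ j
...   | yes _ = i
...   | no _ = k

transpositions : (n : ℕ) → List (Fin n × Fin n)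
transpositions n =
  concatMap (λ i → lmap (λ j → (i , j)) (filter (λ j → i <? j) (allFin n))) (allFin n)

applyT : ∀ {n} → Fin n × Fin n → Vec (Fin n) n → Vec (Fin n) n
applyT (i , j) x = map (swap i j) x

-- τ x as a vertex (τ x is always a permutation, so this never yields nothing;
-- the check only supplies the certificate)
applyP : ∀ {n} → Fin n × Fin n → Perm n → Maybe (Perm n)
applyP t (x , _) with T? (injᵇ (applyT t x))
... | yes p = just (applyT t x , p)
... | no _  = nothing

CayleyTrans : ℕ → Graph
CayleyTrans n = record
  { V    = Perm n
  ; nbrs = λ x → mapMaybe (λ t → applyP t x) (transpositions n)
  }

-- Write ∂ₛf = f(s·x) − f(x). If the generators of a Cayley graph are involutions and the generating
-- set is closed under conjugation, reindexing the double sum over pairs of generators by t ↦ sts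
-- turns the Bochner formula Γ₂ = ½ΔΓ − Γ(f, Δf) into a sum of squares
--   Γ₂(f)(x) = ¼ Σₛ Σₜ (f(tsx) − f(sx) − f(stsx) + f(x))².
-- The diagonal terms t = s alone contribute Σₛ (∂ₛf)² = 2Γ(f)(x), so Ric ≥ 2. The transpositions of
-- Sₙ are such a generating set, and the bound is attained at the identity by f = min(2, d(id, ·)):
-- a product of two distinct transpositions is at distance 2, so every off-diagonal square vanishes.
module Submission where

open import Defs
open import Data.Bool using (Bool; T; _∨_; not; true; false; if_then_else_)
open import Data.Bool.ListAction using (all; and)
open import Data.Bool.Properties using (T-irrelevant)
open import Data.Empty using (⊥)
open import Data.Fin using (Fin; zero; suc; _≟_; _<_; _<?_)
open import Data.Fin.Permutation using (permutation)
open import Data.Fin.Properties using (suc-injective; any?; <-cmp; <-asym; <⇒≢)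
open import Data.List
  using (List; []; _∷_; _++_; allFin; filter; concatMap; mapMaybe; tabulate) renaming (map to lmap)
open import Data.List.Membership.Propositional using (_∈_; lose)
open import Data.List.Membership.Propositional.Properties using (∈-allFin; ∈-map⁺; ∈-filter⁺; ∈-concatMap⁺)
open import Data.List.Properties using (mapMaybe-cong; mapMaybe-map; mapMaybe-just) renaming (map-cong to lmap-cong)
open import Data.List.Relation.Unary.All.Properties using (all⁻) renaming (tabulate⁺ to All-tabulate⁺)
open import Data.List.Relation.Unary.Any using (here; there)
open import Data.Maybe using (just)
open import Data.Nat using (ℕ; zero; suc; _≤_; z≤n; s≤s)
open import Data.Product using (_×_; _,_; ∃-syntax; proj₁; proj₂)
open import Data.Rational using (ℚ; 0ℚ; 1ℚ; _+_; _-_; _*_; -_; ½; _/_; positive; nonNegative; nonPositive)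
import Data.Rational as ℚ
open import Data.Rational.Properties
  using ( +-0-commutativeMonoid; +-identityˡ; +-identityʳ; +-assoc; *-zeroʳ; *-distribˡ-+; neg-distrib-+
        ; ≤-refl; ≤-trans; ≤-reflexive; ≤-total; <-≤-trans; <-irrefl; +-mono-≤; *-monoˡ-≤-nonNeg
        ; *-cancelʳ-≤-pos; nonNegative⁻¹; positive⁻¹; nonNeg*nonNeg⇒nonNeg; nonPos*nonPos⇒nonPos
        ; module ≤-Reasoning )
open import Data.Rational.Solver using (module +-*-Solver)
open import Algebra.Properties.CommutativeMonoid.Sum +-0-commutativeMonoid
  using (sum-syntax; sum-cong-≗; sum-replicate-zero; ∑-comm; ∑-distrib-+; ∑-permute)
open import Data.Sum using (_⊎_; inj₁; inj₂)
open import Data.Unit using (tt)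
open import Data.Vec using (Vec; lookup; map)
import Data.Vec as Vec
open import Data.Vec.Properties using (lookup-map; lookup-allFin; map-cong; map-∘; map-id)
open import Function using (_∘_)
open import Function.Definitions using (Injective)
open import Relation.Binary.Definitions using (tri<; tri≈; tri>)
open import Relation.Binary.PropositionalEquality hiding ([_])
open import Relation.Nullary using (Dec; does; yes; no; ¬_; contradiction)
open import Relation.Nullary.Decidable using (T?; ⌊_⌋; ¬?; _×-dec_)
open import Relation.Unary using (Decidable)

open +-*-Solver using (solve; _:+_; _:*_; _:-_; _:=_; con)

infix 30 _²
infixr 20 [_]·_
infixl 10 sumOver

_² : ℚ → ℚ
q ² = q * q

2ℚ : ℚ
2ℚ = 1ℚ + 1ℚ

¼ : ℚ
¼ = ½ * ½

²-nonNeg : ∀ q → 0ℚ ℚ.≤ q ²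
²-nonNeg q with ≤-total 0ℚ q
... | inj₁ 0≤q = nonNegative⁻¹ (q ²) {{nonNeg*nonNeg⇒nonNeg q {{nonNegative 0≤q}} q {{nonNegative 0≤q}}}}
-- despite its name, nonPos*nonPos⇒nonPos concludes NonNegative
... | inj₂ q≤0 = nonNegative⁻¹ (q ²) {{nonPos*nonPos⇒nonPos q {{nonPositive q≤0}} q {{nonPositive q≤0}}}}

-- Sums over lists and over Fin n

sumOver : {A : Set} → List A → (A → ℚ) → ℚ
sumOver xs h = sumℚ (lmap h xs)

syntax sumOver xs (λ x → e) = ∑[ x ∈ xs ] e

module _ {A : Set} where

  sumOver-cong : (xs : List A) {h k : A → ℚ} → (∀ x → h x ≡ k x) → sumOver xs h ≡ sumOver xs k
  sumOver-cong xs h≗k = cong sumℚ (lmap-cong h≗k xs)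

  sumOver-zero : (xs : List A) → ∑[ x ∈ xs ] 0ℚ ≡ 0ℚ
  sumOver-zero []       = refl
  sumOver-zero (x ∷ xs) = cong (0ℚ +_) (sumOver-zero xs)

  sumOver-distrib-+ : (xs : List A) (h k : A → ℚ) →
                      ∑[ x ∈ xs ] (h x + k x) ≡ sumOver xs h + sumOver xs k
  sumOver-distrib-+ []       h k = refl
  sumOver-distrib-+ (x ∷ xs) h k rewrite sumOver-distrib-+ xs h k =
    solve 4 (λ a b c d → (a :+ b) :+ (c :+ d) := (a :+ c) :+ (b :+ d)) refl
      (h x) (k x) (sumOver xs h) (sumOver xs k)

  *-distribˡ-sumOver : (xs : List A) (c : ℚ) (h : A → ℚ) → c * sumOver xs h ≡ ∑[ x ∈ xs ] (c * h x)
  *-distribˡ-sumOver []       c h = *-zeroʳ c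
  *-distribˡ-sumOver (x ∷ xs) c h =
    trans (*-distribˡ-+ c (h x) (sumOver xs h)) (cong (c * h x +_) (*-distribˡ-sumOver xs c h))

  sumOver-neg : (xs : List A) (h : A → ℚ) → ∑[ x ∈ xs ] (- h x) ≡ - sumOver xs h
  sumOver-neg []       h = refl
  sumOver-neg (x ∷ xs) h =
    trans (cong (- h x +_) (sumOver-neg xs h)) (sym (neg-distrib-+ (h x) (sumOver xs h)))

  sumOver-distrib-- : (xs : List A) (h k : A → ℚ) →
                      ∑[ x ∈ xs ] (h x - k x) ≡ sumOver xs h - sumOver xs k
  sumOver-distrib-- xs h k =
    trans (sumOver-distrib-+ xs h (λ x → - k x)) (cong (sumOver xs h +_) (sumOver-neg xs k))

  sumOver-lincomb : (xs : List A) (c d : ℚ) (h k : A → ℚ) →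
                    c * sumOver xs h - d * sumOver xs k ≡ ∑[ x ∈ xs ] (c * h x - d * k x)
  sumOver-lincomb xs c d h k =
    trans (cong₂ _-_ (*-distribˡ-sumOver xs c h) (*-distribˡ-sumOver xs d k))
          (sym (sumOver-distrib-- xs (λ x → c * h x) (λ x → d * k x)))

  sumOver-++ : (xs ys : List A) (h : A → ℚ) → sumOver (xs ++ ys) h ≡ sumOver xs h + sumOver ys h
  sumOver-++ []       ys h = sym (+-identityˡ _)
  sumOver-++ (x ∷ xs) ys h =
    trans (cong (h x +_) (sumOver-++ xs ys h)) (sym (+-assoc (h x) (sumOver xs h) (sumOver ys h)))

  sumOver-mono : (xs : List A) {h k : A → ℚ} → (∀ {x} → x ∈ xs → h x ℚ.≤ k x) →
                 sumOver xs h ℚ.≤ sumOver xs k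
  sumOver-mono []       h≤k = ≤-refl
  sumOver-mono (x ∷ xs) h≤k = +-mono-≤ (h≤k (here refl)) (sumOver-mono xs (h≤k ∘ there))

  sumOver-nonNeg : (xs : List A) {h : A → ℚ} → (∀ x → 0ℚ ℚ.≤ h x) → 0ℚ ℚ.≤ sumOver xs h
  sumOver-nonNeg xs 0≤h =
    ≤-trans (≤-reflexive (sym (sumOver-zero xs))) (sumOver-mono xs (λ {x} _ → 0≤h x))

  ∈⇒≤-sumOver : {xs : List A} {h : A → ℚ} → (∀ x → 0ℚ ℚ.≤ h x) →
                ∀ {x} → x ∈ xs → h x ℚ.≤ sumOver xs h
  ∈⇒≤-sumOver {y ∷ xs} {h} 0≤h (here refl) =
    ≤-trans (≤-reflexive (sym (+-identityʳ (h y)))) (+-mono-≤ (≤-refl {h y}) (sumOver-nonNeg xs 0≤h))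
  ∈⇒≤-sumOver {y ∷ xs} {h} 0≤h (there x∈xs) =
    ≤-trans (∈⇒≤-sumOver 0≤h x∈xs)
            (≤-trans (≤-reflexive (sym (+-identityˡ _))) (+-mono-≤ (0≤h y) ≤-refl))

module _ {A B : Set} where

  sumOver-map : (g : A → B) (xs : List A) (h : B → ℚ) → sumOver (lmap g xs) h ≡ sumOver xs (h ∘ g)
  sumOver-map g []       h = refl
  sumOver-map g (x ∷ xs) h = cong (h (g x) +_) (sumOver-map g xs h)

  sumOver-concatMap : (g : A → List B) (xs : List A) (h : B → ℚ) →
                      sumOver (concatMap g xs) h ≡ ∑[ x ∈ xs ] sumOver (g x) h
  sumOver-concatMap g []       h = refl
  sumOver-concatMap g (x ∷ xs) h =
    trans (sumOver-++ (g x) (concatMap g xs) h) (cong (sumOver (g x) h +_) (sumOver-concatMap g xs h))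

  sumOver-comm : (xs : List A) (ys : List B) (h : A → B → ℚ) →
                 ∑[ x ∈ xs ] ∑[ y ∈ ys ] h x y ≡ ∑[ y ∈ ys ] ∑[ x ∈ xs ] h x y
  sumOver-comm []       ys h = sym (sumOver-zero ys)
  sumOver-comm (x ∷ xs) ys h =
    trans (cong (sumOver ys (h x) +_) (sumOver-comm xs ys h))
          (sym (sumOver-distrib-+ ys (h x) (λ y → ∑[ x′ ∈ xs ] h x′ y)))

module _ {A B : Set} (xs : List A) (ys : List B) where

  sumOver₂-cong : {h k : A → B → ℚ} → (∀ x y → h x y ≡ k x y) →
                  ∑[ x ∈ xs ] ∑[ y ∈ ys ] h x y ≡ ∑[ x ∈ xs ] ∑[ y ∈ ys ] k x y
  sumOver₂-cong h≗k = sumOver-cong xs (λ x → sumOver-cong ys (h≗k x))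

  sumOver₂-distrib-+ : (h k : A → B → ℚ) →
    ∑[ x ∈ xs ] ∑[ y ∈ ys ] (h x y + k x y)
      ≡ ∑[ x ∈ xs ] ∑[ y ∈ ys ] h x y + ∑[ x ∈ xs ] ∑[ y ∈ ys ] k x y
  sumOver₂-distrib-+ h k =
    trans (sumOver-cong xs (λ x → sumOver-distrib-+ ys (h x) (k x))) (sumOver-distrib-+ xs _ _)

  sumOver₂-distrib-- : (h k : A → B → ℚ) →
    ∑[ x ∈ xs ] ∑[ y ∈ ys ] (h x y - k x y)
      ≡ ∑[ x ∈ xs ] ∑[ y ∈ ys ] h x y - ∑[ x ∈ xs ] ∑[ y ∈ ys ] k x y
  sumOver₂-distrib-- h k =
    trans (sumOver-cong xs (λ x → sumOver-distrib-- ys (h x) (k x))) (sumOver-distrib-- xs _ _)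

  *-distribˡ-sumOver₂ : (c : ℚ) (h : A → B → ℚ) →
    c * ∑[ x ∈ xs ] ∑[ y ∈ ys ] h x y ≡ ∑[ x ∈ xs ] ∑[ y ∈ ys ] (c * h x y)
  *-distribˡ-sumOver₂ c h =
    trans (*-distribˡ-sumOver xs c _) (sumOver-cong xs (λ x → *-distribˡ-sumOver ys c (h x)))

[_]·_ : {P : Set} → Dec P → ℚ → ℚ
[ d ]· v = if does d then v else 0ℚ

[]·-yes : {P : Set} (d : Dec P) {v : ℚ} → P → [ d ]· v ≡ v
[]·-yes (yes _) p = refl
[]·-yes (no ¬p) p = contradiction p ¬p

[]·-no : {P : Set} (d : Dec P) {v : ℚ} → ¬ P → [ d ]· v ≡ 0ℚ
[]·-no (yes p) ¬p = contradiction p ¬p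
[]·-no (no _)  ¬p = refl

[]·-zero : {P : Set} (d : Dec P) → [ d ]· 0ℚ ≡ 0ℚ
[]·-zero (yes _) = refl
[]·-zero (no _)  = refl

[]·-cong : {P : Set} (d : Dec P) {v w : ℚ} → (P → v ≡ w) → [ d ]· v ≡ [ d ]· w
[]·-cong (yes p) v≡w = v≡w p
[]·-cong (no _)  v≡w = refl

[]·-⇔ : {P Q : Set} (d : Dec P) (e : Dec Q) {v : ℚ} → (P → Q) → (Q → P) → [ d ]· v ≡ [ e ]· v
[]·-⇔ (yes _) (yes _) P→Q Q→P = refl
[]·-⇔ (no _)  (no _)  P→Q Q→P = refl
[]·-⇔ (yes p) (no ¬q) P→Q Q→P = contradiction (P→Q p) ¬q
[]·-⇔ (no ¬p) (yes q) P→Q Q→P = contradiction (Q→P q) ¬p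

sumOver-filter : {A : Set} {P : A → Set} (P? : Decidable P) (xs : List A) (h : A → ℚ) →
                 sumOver (filter P? xs) h ≡ ∑[ x ∈ xs ] [ P? x ]· h x
sumOver-filter P? []       h = refl
sumOver-filter P? (x ∷ xs) h with does (P? x)
... | true  = cong (h x +_) (sumOver-filter P? xs h)
... | false = trans (sumOver-filter P? xs h) (sym (+-identityˡ _))

sumOver-tabulate : ∀ {n} {A : Set} (g : Fin n → A) (h : A → ℚ) →
                   sumOver (tabulate g) h ≡ ∑[ i < n ] h (g i)
sumOver-tabulate {zero}  g h = refl
sumOver-tabulate {suc n} g h = cong (h (g zero) +_) (sumOver-tabulate (g ∘ suc) h)

sumOver-allFin : ∀ {n} (h : Fin n → ℚ) → ∑[ i ∈ allFin n ] h i ≡ ∑[ i < n ] h i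
sumOver-allFin = sumOver-tabulate (λ i → i)

∑-zero : ∀ {n} (h : Fin n → ℚ) → (∀ i → h i ≡ 0ℚ) → ∑[ i < n ] h i ≡ 0ℚ
∑-zero {n} h h≡0 = trans (sum-cong-≗ h≡0) (sum-replicate-zero n)

∑-supported : ∀ {n} (h : Fin n → ℚ) (a : Fin n) → (∀ i → i ≢ a → h i ≡ 0ℚ) → ∑[ i < n ] h i ≡ h a
∑-supported {suc n} h zero    h≡0 = begin
  h zero + ∑[ i < n ] h (suc i)     ≡⟨ cong (h zero +_) (∑-zero (h ∘ suc) (λ i → h≡0 (suc i) λ ())) ⟩
  h zero + 0ℚ                       ≡⟨ +-identityʳ (h zero) ⟩
  h zero                            ∎
  where open ≡-Reasoning
∑-supported {suc n} h (suc a) h≡0 = begin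
  h zero + ∑[ i < n ] h (suc i)     ≡⟨ cong (_+ ∑[ i < n ] h (suc i)) (h≡0 zero λ ()) ⟩
  0ℚ + ∑[ i < n ] h (suc i)         ≡⟨ +-identityˡ _ ⟩
  ∑[ i < n ] h (suc i)
    ≡⟨ ∑-supported (h ∘ suc) a (λ i i≢a → h≡0 (suc i) (i≢a ∘ suc-injective)) ⟩
  h (suc a)                         ∎
  where open ≡-Reasoning

∑-involution : ∀ {n} (σ : Fin n → Fin n) → (∀ i → σ (σ i) ≡ i) → (h : Fin n → ℚ) →
               ∑[ i < n ] h (σ i) ≡ ∑[ i < n ] h i
∑-involution σ σσ≡id h = sym (∑-permute h (permutation σ σ σσ≡id σσ≡id))

-- Curvature

RicIs-attained : (G : Graph) {K : ℚ} → CurvBound G K → (f : V G → ℚ) (x : V G) →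
                 Γ₂ G f x ≡ K * Γ G f x → 0ℚ ℚ.< Γ G f x → RicIs G K
RicIs-attained G {K} bound f x Γ₂≡KΓ 0<Γ =
  bound , λ K′ K<K′ bound′ → <-irrefl refl (<-≤-trans K<K′ (K′≤K K′ bound′))
  where
  K′≤K : ∀ K′ → CurvBound G K′ → K′ ℚ.≤ K
  K′≤K K′ bound′ =
    *-cancelʳ-≤-pos (Γ G f x) {{positive 0<Γ}} (≤-trans (bound′ f x) (≤-reflexive Γ₂≡KΓ))

module GeneratorGraph (G : Graph) {S : Set} (gens : List S) (_·_ : S → V G → V G)
                      (nbrs-gens : ∀ y → nbrs G y ≡ lmap (_· y) gens) where

  sum-nbrs : (h : V G → ℚ) (y : V G) → sumℚ (lmap h (nbrs G y)) ≡ ∑[ t ∈ gens ] h (t · y)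
  sum-nbrs h y = trans (cong (λ ys → sumOver ys h) (nbrs-gens y)) (sumOver-map (_· y) gens h)

  Δ-gens : (h : V G → ℚ) (y : V G) → Δ G h y ≡ ∑[ t ∈ gens ] (h (t · y) - h y)
  Δ-gens h y = sum-nbrs (λ z → h z - h y) y

  Γ-gens : (h : V G → ℚ) (y : V G) → Γ G h y ≡ ½ * ∑[ t ∈ gens ] (h y - h (t · y)) ²
  Γ-gens h y = cong (½ *_) (sum-nbrs (λ z → (h y - h z) ²) y)

  Γ⟨,⟩-gens : (h k : V G → ℚ) (y : V G) →
              Γ⟨_,_⟩ G h k y ≡ ½ * ∑[ t ∈ gens ] ((h y - h (t · y)) * (k y - k (t · y)))
  Γ⟨,⟩-gens h k y = cong (½ *_) (sum-nbrs (λ z → (h y - h z) * (k y - k z)) y)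

  module Differences (f : V G → ℚ) (x : V G) where

    ∂ : S → ℚ
    ∂ s = f (s · x) - f x

    ∂² : S → S → ℚ
    ∂² s t = f (t · (s · x)) - f x

    Γ₂-gens : Γ₂ G f x ≡ ¼ * ∑[ s ∈ gens ] ∑[ t ∈ gens ] ((∂² s t - (∂ s + ∂ s)) ² - (∂ s - ∂ t) ²)
    Γ₂-gens = begin
      ½ * Δ G (Γ G f) x - Γ⟨_,_⟩ G f (Δ G f) x
        ≡⟨ cong₂ (λ p q → ½ * p - q) (Δ-gens (Γ G f) x) (Γ⟨,⟩-gens f (Δ G f) x) ⟩
      ½ * ∑[ s ∈ gens ] (Γ G f (s · x) - Γ G f x)
        - ½ * ∑[ s ∈ gens ] ((X - Y s) * (Δ G f x - Δ G f (s · x)))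
        ≡⟨ cong₂ (λ p q → ½ * p - ½ * q) (sumOver-cong gens ΔΓ-inner) (sumOver-cong gens ΓΔ-inner) ⟩
      ½ * ∑[ s ∈ gens ] ∑[ t ∈ gens ] P s t - ½ * ∑[ s ∈ gens ] ∑[ t ∈ gens ] R s t
        ≡⟨ cong₂ _-_ (*-distribˡ-sumOver₂ gens gens ½ P) (*-distribˡ-sumOver₂ gens gens ½ R) ⟩
      ∑[ s ∈ gens ] ∑[ t ∈ gens ] (½ * P s t) - ∑[ s ∈ gens ] ∑[ t ∈ gens ] (½ * R s t)
        ≡⟨ sumOver₂-distrib-- gens gens _ _ ⟨
      ∑[ s ∈ gens ] ∑[ t ∈ gens ] (½ * P s t - ½ * R s t)
        ≡⟨ sumOver₂-cong gens gens (λ s t → pointwise X (Y s) (Y t) (Z s t)) ⟩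
      ∑[ s ∈ gens ] ∑[ t ∈ gens ] (¼ * ((∂² s t - (∂ s + ∂ s)) ² - (∂ s - ∂ t) ²))
        ≡⟨ *-distribˡ-sumOver₂ gens gens ¼ _ ⟨
      ¼ * ∑[ s ∈ gens ] ∑[ t ∈ gens ] ((∂² s t - (∂ s + ∂ s)) ² - (∂ s - ∂ t) ²) ∎
      where
      open ≡-Reasoning

      X : ℚ
      X = f x

      Y : S → ℚ
      Y s = f (s · x)

      Z : S → S → ℚ
      Z s t = f (t · (s · x))

      P R : S → S → ℚ
      P s t = ½ * (Y s - Z s t) ² - ½ * (X - Y t) ²
      R s t = (X - Y s) * (Y t - X - (Z s t - Y s))

      ΔΓ-inner : ∀ s → Γ G f (s · x) - Γ G f x ≡ ∑[ t ∈ gens ] P s t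
      ΔΓ-inner s = trans (cong₂ _-_ (Γ-gens f (s · x)) (Γ-gens f x)) (sumOver-lincomb gens ½ ½ _ _)

      ΓΔ-inner : ∀ s → (X - Y s) * (Δ G f x - Δ G f (s · x)) ≡ ∑[ t ∈ gens ] R s t
      ΓΔ-inner s = begin
        (X - Y s) * (Δ G f x - Δ G f (s · x))
          ≡⟨ cong ((X - Y s) *_) (cong₂ _-_ (Δ-gens f x) (Δ-gens f (s · x))) ⟩
        (X - Y s) * (∑[ t ∈ gens ] (Y t - X) - ∑[ t ∈ gens ] (Z s t - Y s))
          ≡⟨ cong ((X - Y s) *_) (sumOver-distrib-- gens _ _) ⟨
        (X - Y s) * ∑[ t ∈ gens ] (Y t - X - (Z s t - Y s))
          ≡⟨ *-distribˡ-sumOver gens (X - Y s) _ ⟩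
        ∑[ t ∈ gens ] R s t ∎

      pointwise : ∀ X Ys Yt Z →
        ½ * (½ * (Ys - Z) ² - ½ * (X - Yt) ²) - ½ * ((X - Ys) * (Yt - X - (Z - Ys)))
          ≡ ¼ * ((Z - X - ((Ys - X) + (Ys - X))) ² - ((Ys - X) - (Yt - X)) ²)
      pointwise = solve 4 (λ X Ys Yt Z →
        con ½ :* (con ½ :* ((Ys :- Z) :* (Ys :- Z)) :- con ½ :* ((X :- Yt) :* (X :- Yt)))
          :- con ½ :* ((X :- Ys) :* (Yt :- X :- (Z :- Ys)))
        := con ¼ :* ((Z :- X :- ((Ys :- X) :+ (Ys :- X))) :* (Z :- X :- ((Ys :- X) :+ (Ys :- X)))
          :- ((Ys :- X) :- (Yt :- X)) :* ((Ys :- X) :- (Yt :- X)))) refl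

module ConjugationInvariant
  (G : Graph) {S : Set} (gens : List S) (_·_ : S → V G → V G)
  (nbrs-gens : ∀ y → nbrs G y ≡ lmap (_· y) gens)
  (·-involutive : ∀ s y → s · (s · y) ≡ y)
  (conj : S → S → S)
  (·-conj : ∀ s t y → t · (s · y) ≡ s · (conj s t · y))
  (sumOver-conj : ∀ s y (h : V G → ℚ) → ∑[ t ∈ gens ] h (conj s t · y) ≡ ∑[ t ∈ gens ] h (t · y))
  where

  open GeneratorGraph G gens _·_ nbrs-gens public

  conj-diagonal : ∀ s y → conj s s · y ≡ s · y
  conj-diagonal s y = begin
    conj s s · y               ≡⟨ ·-involutive s _ ⟨
    s · (s · (conj s s · y))   ≡⟨ cong (s ·_) (·-conj s s y) ⟨
    s · (s · (s · y))          ≡⟨ cong (s ·_) (·-involutive s y) ⟩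
    s · y                      ∎
    where open ≡-Reasoning

  module _ (f : V G → ℚ) (x : V G) where
    open Differences f x

    -- As t · (s · x) ≡ s · (c · x) for c = conj s t, this is the mixed second difference
    -- f(s c x) − f(s x) − f(c x) + f(x).
    mixed : S → S → ℚ
    mixed s t = ∂² s t - ∂ s - ∂ (conj s t)

    sumOver-conj-∂ : ∀ s → ∑[ t ∈ gens ] (∂ s - ∂ t) ² ≡ ∑[ t ∈ gens ] (∂ s - ∂ (conj s t)) ²
    sumOver-conj-∂ s = sym (sumOver-conj s x (λ z → (∂ s - (f z - f x)) ²))

    sumOver₂-conj-∂² : ∑[ s ∈ gens ] ∑[ t ∈ gens ] (∂² s t - (∂ s + ∂ s)) ²
                     ≡ ∑[ s ∈ gens ] ∑[ t ∈ gens ] (∂² s t - (∂ (conj s t) + ∂ (conj s t))) ²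
    sumOver₂-conj-∂² = begin
      ∑[ s ∈ gens ] ∑[ t ∈ gens ] (∂² s t - (∂ s + ∂ s)) ²
        ≡⟨ sumOver-comm gens gens _ ⟩
      ∑[ s ∈ gens ] ∑[ t ∈ gens ] φ s (t · x)
        ≡⟨ sumOver-cong gens (λ s → sumOver-conj s x (φ s)) ⟨
      ∑[ s ∈ gens ] ∑[ t ∈ gens ] φ s (conj s t · x)
        ≡⟨ sumOver₂-cong gens gens (λ s t → cong (λ y → (f y - f x - (∂ (conj s t) + ∂ (conj s t))) ²)
                                                 (·-conj s t x)) ⟨
      ∑[ s ∈ gens ] ∑[ t ∈ gens ] (∂² s t - (∂ (conj s t) + ∂ (conj s t))) ² ∎
      where
      open ≡-Reasoning
      φ : S → V G → ℚ
      φ s z = (f (s · z) - f x - ((f z - f x) + (f z - f x))) ²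

    Γ₂-sumOfSquares : Γ₂ G f x ≡ ¼ * ∑[ s ∈ gens ] ∑[ t ∈ gens ] (mixed s t) ²
    Γ₂-sumOfSquares = trans Γ₂-gens (cong (¼ *_) (begin
      ∑∑ (λ s t → U s t - D s t)
        ≡⟨ sumOver₂-distrib-- gens gens U D ⟩
      ∑∑ U - ∑∑ D
        ≡⟨ cong₂ _-_ (halves (∑∑ U)) (sumOver-cong gens sumOver-conj-∂) ⟩
      ½ * ∑∑ U + ½ * ∑∑ U - ∑∑ D′
        ≡⟨ cong (λ u → ½ * ∑∑ U + ½ * u - ∑∑ D′) sumOver₂-conj-∂² ⟩
      ½ * ∑∑ U + ½ * ∑∑ U′ - ∑∑ D′
        ≡⟨ cong₂ (λ p q → p + q - ∑∑ D′) (*-distribˡ-sumOver₂ gens gens ½ U)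
                                         (*-distribˡ-sumOver₂ gens gens ½ U′) ⟩
      ∑∑ (λ s t → ½ * U s t) + ∑∑ (λ s t → ½ * U′ s t) - ∑∑ D′
        ≡⟨ cong (_- ∑∑ D′) (sumOver₂-distrib-+ gens gens _ _) ⟨
      ∑∑ (λ s t → ½ * U s t + ½ * U′ s t) - ∑∑ D′
        ≡⟨ sumOver₂-distrib-- gens gens _ D′ ⟨
      ∑∑ (λ s t → ½ * U s t + ½ * U′ s t - D′ s t)
        ≡⟨ sumOver₂-cong gens gens (λ s t → average (∂² s t) (∂ s) (∂ (conj s t))) ⟩
      ∑∑ (λ s t → (mixed s t) ²) ∎))
      where
      open ≡-Reasoning

      ∑∑ : (S → S → ℚ) → ℚ
      ∑∑ h = ∑[ s ∈ gens ] ∑[ t ∈ gens ] h s t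

      U U′ D D′ : S → S → ℚ
      U s t = (∂² s t - (∂ s + ∂ s)) ²
      U′ s t = (∂² s t - (∂ (conj s t) + ∂ (conj s t))) ²
      D s t = (∂ s - ∂ t) ²
      D′ s t = (∂ s - ∂ (conj s t)) ²

      halves : ∀ u → u ≡ ½ * u + ½ * u
      halves = solve 1 (λ u → u := con ½ :* u :+ con ½ :* u) refl

      average : ∀ g a c → ½ * (g - (a + a)) ² + ½ * (g - (c + c)) ² - (a - c) ² ≡ (g - a - c) ²
      average = solve 3 (λ g a c →
        con ½ :* ((g :- (a :+ a)) :* (g :- (a :+ a))) :+ con ½ :* ((g :- (c :+ c)) :* (g :- (c :+ c)))
          :- (a :- c) :* (a :- c)
        := (g :- a :- c) :* (g :- a :- c)) refl

    2Γ≡diagonal : 2ℚ * Γ G f x ≡ ¼ * ∑[ s ∈ gens ] (mixed s s) ²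
    2Γ≡diagonal = begin
      2ℚ * Γ G f x
        ≡⟨ cong (2ℚ *_) (Γ-gens f x) ⟩
      2ℚ * (½ * ∑[ s ∈ gens ] (f x - f (s · x)) ²)
        ≡⟨ solve 1 (λ q → con 2ℚ :* (con ½ :* q) := q) refl _ ⟩
      ∑[ s ∈ gens ] (f x - f (s · x)) ²
        ≡⟨ sumOver-cong gens diagonal ⟩
      ∑[ s ∈ gens ] (¼ * (mixed s s) ²)
        ≡⟨ *-distribˡ-sumOver gens ¼ _ ⟨
      ¼ * ∑[ s ∈ gens ] (mixed s s) ² ∎
      where
      open ≡-Reasoning
      diagonal : ∀ s → (f x - f (s · x)) ² ≡ ¼ * (mixed s s) ²
      diagonal s = begin
        (f x - f (s · x)) ²
          ≡⟨ solve 2 (λ X Y → (X :- Y) :* (X :- Y)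
               := con ¼ :* ((X :- X :- (Y :- X) :- (Y :- X)) :* (X :- X :- (Y :- X) :- (Y :- X))))
               refl (f x) (f (s · x)) ⟩
        ¼ * (f x - f x - ∂ s - ∂ s) ²
          ≡⟨ cong₂ (λ y z → ¼ * (f y - f x - ∂ s - (f z - f x)) ²)
                   (·-involutive s x) (conj-diagonal s x) ⟨
        ¼ * (mixed s s) ² ∎

    2Γ≤Γ₂ : 2ℚ * Γ G f x ℚ.≤ Γ₂ G f x
    2Γ≤Γ₂ = begin
      2ℚ * Γ G f x
        ≡⟨ 2Γ≡diagonal ⟩
      ¼ * ∑[ s ∈ gens ] (mixed s s) ²
        ≤⟨ *-monoˡ-≤-nonNeg ¼ (sumOver-mono gens (λ {s} → ∈⇒≤-sumOver (λ t → ²-nonNeg (mixed s t)))) ⟩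
      ¼ * ∑[ s ∈ gens ] ∑[ t ∈ gens ] (mixed s t) ²
        ≡⟨ Γ₂-sumOfSquares ⟨
      Γ₂ G f x ∎
      where open ≤-Reasoning

    Γ₂≡2Γ : ∑[ s ∈ gens ] ∑[ t ∈ gens ] (mixed s t) ² ≡ ∑[ s ∈ gens ] (mixed s s) ² →
            Γ₂ G f x ≡ 2ℚ * Γ G f x
    Γ₂≡2Γ ∑∑≡∑diagonal =
      trans Γ₂-sumOfSquares (trans (cong (¼ *_) ∑∑≡∑diagonal) (sym 2Γ≡diagonal))

  curvature≥2 : CurvBound G 2ℚ
  curvature≥2 = 2Γ≤Γ₂

-- Transpositions

module _ {n : ℕ} where

  swap-matchˡ : (i j : Fin n) → swap i j i ≡ j
  swap-matchˡ i j with i ≟ i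
  ... | yes _   = refl
  ... | no i≢i = contradiction refl i≢i

  swap-matchʳ : (i j : Fin n) → swap i j j ≡ i
  swap-matchʳ i j with j ≟ i
  ... | yes j≡i = j≡i
  ... | no _ with j ≟ j
  ...   | yes _   = refl
  ...   | no j≢j = contradiction refl j≢j

  swap-noMatch : {i j k : Fin n} → k ≢ i → k ≢ j → swap i j k ≡ k
  swap-noMatch {i} {j} {k} k≢i k≢j with k ≟ i
  ... | yes k≡i = contradiction k≡i k≢i
  ... | no _ with k ≟ j
  ...   | yes k≡j = contradiction k≡j k≢j
  ...   | no _    = refl

  data SwapCase (i j k : Fin n) : Set where
    at-i  : k ≡ i → SwapCase i j k
    at-j  : k ≢ i → k ≡ j → SwapCase i j k
    fixed : k ≢ i → k ≢ j → SwapCase i j k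

  swapCase : (i j k : Fin n) → SwapCase i j k
  swapCase i j k with k ≟ i | k ≟ j
  ... | yes k≡i | _       = at-i k≡i
  ... | no k≢i  | yes k≡j = at-j k≢i k≡j
  ... | no k≢i  | no k≢j  = fixed k≢i k≢j

  swap-involutive : (i j k : Fin n) → swap i j (swap i j k) ≡ k
  swap-involutive i j k with swapCase i j k
  ... | at-i refl      = trans (cong (swap k j) (swap-matchˡ k j)) (swap-matchʳ k j)
  ... | at-j _ refl    = trans (cong (swap i k) (swap-matchʳ i k)) (swap-matchˡ i k)
  ... | fixed k≢i k≢j = trans (cong (swap i j) (swap-noMatch k≢i k≢j)) (swap-noMatch k≢i k≢j)

  swap-comm : (i j k : Fin n) → swap i j k ≡ swap j i k
  swap-comm i j k with swapCase i j k
  ... | at-i refl      = trans (swap-matchˡ k j) (sym (swap-matchʳ j k))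
  ... | at-j _ refl    = trans (swap-matchʳ i k) (sym (swap-matchˡ k i))
  ... | fixed k≢i k≢j = trans (swap-noMatch k≢i k≢j) (sym (swap-noMatch k≢j k≢i))

  swap-injective : (i j : Fin n) → Injective _≡_ _≡_ (swap i j)
  swap-injective i j {k} {l} eq = begin
    k                        ≡⟨ swap-involutive i j k ⟨
    swap i j (swap i j k)    ≡⟨ cong (swap i j) eq ⟩
    swap i j (swap i j l)    ≡⟨ swap-involutive i j l ⟩
    l                        ∎
    where open ≡-Reasoning

  swap-conj : (σ : Fin n → Fin n) → Injective _≡_ _≡_ σ → (i j k : Fin n) →
              swap (σ i) (σ j) (σ k) ≡ σ (swap i j k)
  swap-conj σ σ-inj i j k with swapCase i j k
  ... | at-i refl      = trans (swap-matchˡ (σ k) (σ j)) (cong σ (sym (swap-matchˡ k j)))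
  ... | at-j _ refl    = trans (swap-matchʳ (σ i) (σ k)) (cong σ (sym (swap-matchʳ i k)))
  ... | fixed k≢i k≢j =
    trans (swap-noMatch (k≢i ∘ σ-inj) (k≢j ∘ σ-inj)) (cong σ (sym (swap-noMatch k≢i k≢j)))

  swap-exchanges : {i j k l : Fin n} → swap i j k ≡ l → k ≢ l → (k ≡ i × l ≡ j) ⊎ (k ≡ j × l ≡ i)
  swap-exchanges {i} {j} {k} swap≡l k≢l with swapCase i j k
  ... | at-i refl      = inj₁ (refl , trans (sym swap≡l) (swap-matchˡ i j))
  ... | at-j _ refl    = inj₂ (refl , trans (sym swap≡l) (swap-matchʳ i j))
  ... | fixed k≢i k≢j = contradiction (trans (sym (swap-noMatch k≢i k≢j)) swap≡l) k≢l

  swap-moved : {i j k : Fin n} → swap i j k ≢ k → k ≡ i ⊎ k ≡ j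
  swap-moved {i} {j} {k} moved with swap-exchanges {l = swap i j k} refl (moved ∘ sym)
  ... | inj₁ (k≡i , _) = inj₁ k≡i
  ... | inj₂ (k≡j , _) = inj₂ k≡j

  swap-movesˡ : {i j : Fin n} → i ≢ j → swap i j i ≢ i
  swap-movesˡ {i} {j} i≢j swap≡i = i≢j (trans (sym swap≡i) (swap-matchˡ i j))

  swap-movesʳ : {i j : Fin n} → i ≢ j → swap i j j ≢ j
  swap-movesʳ {i} {j} i≢j swap≡j = i≢j (trans (sym (swap-matchʳ i j)) swap≡j)

  same-ends : {a b i j : Fin n} → a < b → i < j → (a ≡ i × b ≡ j) ⊎ (a ≡ j × b ≡ i) → (i , j) ≡ (a , b)
  same-ends a<b i<j (inj₁ (refl , refl)) = refl
  same-ends a<b i<j (inj₂ (refl , refl)) = contradiction i<j (<-asym a<b)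

  fresh-end : {a b i j : Fin n} → a < b → i < j → (i , j) ≢ (a , b) →
              ∃[ c ] c ≢ a × c ≢ b × swap i j c ≢ c
  fresh-end {a} {b} {i} {j} a<b i<j ij≢ab with i ≟ a | i ≟ b
  ... | no i≢a  | no i≢b  = i , i≢a , i≢b , swap-movesˡ (<⇒≢ i<j)
  ... | yes i≡a | _       = j , (λ j≡a → <⇒≢ i<j (trans i≡a (sym j≡a)))
                              , (λ j≡b → ij≢ab (cong₂ _,_ i≡a j≡b))
                              , swap-movesʳ (<⇒≢ i<j)
  ... | no _    | yes i≡b = j , (λ j≡a → ij≢ab (same-ends a<b i<j (inj₂ (sym j≡a , sym i≡b))))
                              , (λ j≡b → <⇒≢ i<j (trans i≡b (sym j≡b)))
                              , swap-movesʳ (<⇒≢ i<j)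

  ⌊≟⌋-injective : (σ : Fin n → Fin n) → Injective _≡_ _≡_ σ → (i j : Fin n) →
                  ⌊ σ i ≟ σ j ⌋ ≡ ⌊ i ≟ j ⌋
  ⌊≟⌋-injective σ σ-inj i j with i ≟ j | σ i ≟ σ j
  ... | yes _    | yes _     = refl
  ... | no _     | no _      = refl
  ... | yes refl | no σi≢σi  = contradiction refl σi≢σi
  ... | no i≢j   | yes σi≡σj = contradiction (σ-inj σi≡σj) i≢j

  injᵇ-map : (σ : Fin n → Fin n) → Injective _≡_ _≡_ σ → (v : Vec (Fin n) n) → injᵇ (map σ v) ≡ injᵇ v
  injᵇ-map σ σ-inj v = all-cong λ i → all-cong λ j → cong (λ b → ⌊ i ≟ j ⌋ ∨ not b) (begin
    ⌊ lookup (map σ v) i ≟ lookup (map σ v) j ⌋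
      ≡⟨ cong₂ (λ p q → ⌊ p ≟ q ⌋) (lookup-map i σ v) (lookup-map j σ v) ⟩
    ⌊ σ (lookup v i) ≟ σ (lookup v j) ⌋
      ≡⟨ ⌊≟⌋-injective σ σ-inj (lookup v i) (lookup v j) ⟩
    ⌊ lookup v i ≟ lookup v j ⌋ ∎)
    where
    open ≡-Reasoning
    all-cong : {p q : Fin n → Bool} → (∀ i → p i ≡ q i) → all p (allFin n) ≡ all q (allFin n)
    all-cong p≗q = cong and (lmap-cong p≗q (allFin n))

  injᵇ-complete : (v : Vec (Fin n) n) → (∀ {i j} → lookup v i ≡ lookup v j → i ≡ j) → T (injᵇ v)
  injᵇ-complete v v-inj = all⁻ _ (All-tabulate⁺ λ i → all⁻ _ (All-tabulate⁺ λ j → entry i j))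
    where
    entry : ∀ i j → T (⌊ i ≟ j ⌋ ∨ not ⌊ lookup v i ≟ lookup v j ⌋)
    entry i j with i ≟ j
    ... | yes _ = tt
    ... | no i≢j with lookup v i ≟ lookup v j
    ...   | yes vi≡vj = contradiction (v-inj vi≡vj) i≢j
    ...   | no _      = tt

  ι : Perm n
  ι = Vec.allFin n ,
      injᵇ-complete (Vec.allFin n) (λ {i} {j} eq → trans (sym (lookup-allFin i)) (trans eq (lookup-allFin j)))

  infixr 5 _·_

  _·_ : Fin n × Fin n → Perm n → Perm n
  (i , j) · (v , v-inj) = applyT (i , j) v , subst T (sym (injᵇ-map (swap i j) (swap-injective i j) v)) v-inj

  ⟦_⟧ : Perm n → Fin n → Fin n
  ⟦ y ⟧ = lookup (proj₁ y)

  ⟦·⟧ : ∀ i j y k → ⟦ (i , j) · y ⟧ k ≡ swap i j (⟦ y ⟧ k)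
  ⟦·⟧ i j (v , _) k = lookup-map k (swap i j) v

  Perm-≡ : {y z : Perm n} → proj₁ y ≡ proj₁ z → y ≡ z
  Perm-≡ {v , p} {.v , q} refl = cong (v ,_) (T-irrelevant p q)

  applyP≡just : (t : Fin n × Fin n) (y : Perm n) → applyP t y ≡ just (t · y)
  applyP≡just t y with T? (injᵇ (applyT t (proj₁ y)))
  ... | yes _      = cong just (Perm-≡ refl)
  ... | no ¬τy-inj = contradiction (proj₂ (t · y)) ¬τy-inj

  nbrs-CayleyTrans : (y : Perm n) → nbrs (CayleyTrans n) y ≡ lmap (_· y) (transpositions n)
  nbrs-CayleyTrans y = begin
    mapMaybe (λ t → applyP t y) (transpositions n)
      ≡⟨ mapMaybe-cong (λ t → applyP≡just t y) (transpositions n) ⟩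
    mapMaybe (just ∘ (_· y)) (transpositions n)
      ≡⟨ mapMaybe-map just (_· y) (transpositions n) ⟨
    mapMaybe just (lmap (_· y) (transpositions n))
      ≡⟨ mapMaybe-just _ ⟩
    lmap (_· y) (transpositions n) ∎
    where open ≡-Reasoning

  ·-involutive : (t : Fin n × Fin n) (y : Perm n) → t · (t · y) ≡ y
  ·-involutive (i , j) (v , _) = Perm-≡ (begin
    map (swap i j) (map (swap i j) v)   ≡⟨ map-∘ (swap i j) (swap i j) v ⟨
    map (swap i j ∘ swap i j) v         ≡⟨ map-cong (swap-involutive i j) v ⟩
    map (λ k → k) v                     ≡⟨ map-id v ⟩
    v                                   ∎)
    where open ≡-Reasoning

  ·-comm : (i j : Fin n) (y : Perm n) → (i , j) · y ≡ (j , i) · y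
  ·-comm i j (v , _) = Perm-≡ (map-cong (swap-comm i j) v)

  conj : Fin n × Fin n → Fin n × Fin n → Fin n × Fin n
  conj (a , b) (i , j) = swap a b i , swap a b j

  ·-conj : (s t : Fin n × Fin n) (y : Perm n) → t · (s · y) ≡ s · (conj s t · y)
  ·-conj (a , b) (i , j) (v , _) = Perm-≡ (begin
    map (swap i j) (map σ v)               ≡⟨ map-∘ (swap i j) σ v ⟨
    map (swap i j ∘ σ) v                   ≡⟨ map-cong pointwise v ⟩
    map (σ ∘ swap (σ i) (σ j)) v           ≡⟨ map-∘ σ (swap (σ i) (σ j)) v ⟩
    map σ (map (swap (σ i) (σ j)) v)       ∎)
    where
    open ≡-Reasoning
    σ : Fin n → Fin n
    σ = swap a b
    pointwise : ∀ k → swap i j (σ k) ≡ σ (swap (σ i) (σ j) k)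
    pointwise k =
      trans (cong₂ (λ p q → swap p q (σ k)) (sym (swap-involutive a b i)) (sym (swap-involutive a b j)))
            (swap-conj σ (swap-injective a b) (σ i) (σ j) k)

  transpositionsFrom : Fin n → List (Fin n × Fin n)
  transpositionsFrom i = lmap (i ,_) (filter (i <?_) (allFin n))

  ∈-transpositions : {i j : Fin n} → i < j → (i , j) ∈ transpositions n
  ∈-transpositions {i} {j} i<j =
    ∈-concatMap⁺ transpositionsFrom (lose (∈-allFin i) (∈-map⁺ (i ,_) (∈-filter⁺ (i <?_) (∈-allFin j) i<j)))

  sumOver-transpositions : (H : Fin n × Fin n → ℚ) →
    ∑[ t ∈ transpositions n ] H t ≡ ∑[ i < n ] ∑[ j < n ] [ i <? j ]· H (i , j)
  sumOver-transpositions H = begin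
    ∑[ t ∈ transpositions n ] H t
      ≡⟨ sumOver-concatMap transpositionsFrom (allFin n) H ⟩
    ∑[ i ∈ allFin n ] sumOver (transpositionsFrom i) H
      ≡⟨ sumOver-cong (allFin n) (λ i → sumOver-map (i ,_) (filter (i <?_) (allFin n)) H) ⟩
    ∑[ i ∈ allFin n ] sumOver (filter (i <?_) (allFin n)) (λ j → H (i , j))
      ≡⟨ sumOver-cong (allFin n) (λ i → sumOver-filter (i <?_) (allFin n) (λ j → H (i , j))) ⟩
    ∑[ i ∈ allFin n ] ∑[ j ∈ allFin n ] [ i <? j ]· H (i , j)
      ≡⟨ sumOver-cong (allFin n) (λ i → sumOver-allFin (λ j → [ i <? j ]· H (i , j))) ⟩
    ∑[ i ∈ allFin n ] ∑[ j < n ] [ i <? j ]· H (i , j)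
      ≡⟨ sumOver-allFin (λ i → ∑[ j < n ] [ i <? j ]· H (i , j)) ⟩
    ∑[ i < n ] ∑[ j < n ] [ i <? j ]· H (i , j) ∎
    where open ≡-Reasoning

  sumOver-transpositions-cong : {H K : Fin n × Fin n → ℚ} → (∀ {i j} → i < j → H (i , j) ≡ K (i , j)) →
    ∑[ t ∈ transpositions n ] H t ≡ ∑[ t ∈ transpositions n ] K t
  sumOver-transpositions-cong {H} {K} H≡K = begin
    ∑[ t ∈ transpositions n ] H t
      ≡⟨ sumOver-transpositions H ⟩
    ∑[ i < n ] ∑[ j < n ] [ i <? j ]· H (i , j)
      ≡⟨ sum-cong-≗ (λ i → sum-cong-≗ (λ j → []·-cong (i <? j) H≡K)) ⟩
    ∑[ i < n ] ∑[ j < n ] [ i <? j ]· K (i , j)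
      ≡⟨ sumOver-transpositions K ⟨
    ∑[ t ∈ transpositions n ] K t ∎
    where open ≡-Reasoning

  sumOver-transpositions-supported : {a b : Fin n} (H : Fin n × Fin n → ℚ) → a < b →
    (∀ {i j} → i < j → (i , j) ≢ (a , b) → H (i , j) ≡ 0ℚ) → ∑[ t ∈ transpositions n ] H t ≡ H (a , b)
  sumOver-transpositions-supported {a} {b} H a<b H≡0 = begin
    ∑[ t ∈ transpositions n ] H t
      ≡⟨ sumOver-transpositions H ⟩
    ∑[ i < n ] ∑[ j < n ] term i j
      ≡⟨ ∑-supported (λ i → ∑[ j < n ] term i j) a
                     (λ i i≢a → ∑-zero (term i) (λ j → vanishes (i≢a ∘ cong proj₁))) ⟩
    ∑[ j < n ] term a j
      ≡⟨ ∑-supported (term a) b (λ j j≢b → vanishes (j≢b ∘ cong proj₂)) ⟩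
    term a b
      ≡⟨ []·-yes (a <? b) a<b ⟩
    H (a , b) ∎
    where
    open ≡-Reasoning
    term : Fin n → Fin n → ℚ
    term i j = [ i <? j ]· H (i , j)
    vanishes : ∀ {i j} → (i , j) ≢ (a , b) → term i j ≡ 0ℚ
    vanishes {i} {j} ij≢ab = trans ([]·-cong (i <? j) (λ i<j → H≡0 i<j ij≢ab)) ([]·-zero (i <? j))

  sumOver-transpositions-offDiagonal : (H : Fin n × Fin n → ℚ) → (∀ i j → H (i , j) ≡ H (j , i)) →
    ∑[ i < n ] ∑[ j < n ] [ ¬? (i ≟ j) ]· H (i , j)
      ≡ ∑[ t ∈ transpositions n ] H t + ∑[ t ∈ transpositions n ] H t
  sumOver-transpositions-offDiagonal H H-sym = begin
    ∑[ i < n ] ∑[ j < n ] [ ¬? (i ≟ j) ]· H (i , j)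
      ≡⟨ sum-cong-≗ (λ i → sum-cong-≗ (split i)) ⟩
    ∑[ i < n ] ∑[ j < n ] (term i j + term j i)
      ≡⟨ sum-cong-≗ (λ i → ∑-distrib-+ (term i) (λ j → term j i)) ⟩
    ∑[ i < n ] (∑[ j < n ] term i j + ∑[ j < n ] term j i)
      ≡⟨ ∑-distrib-+ (λ i → ∑[ j < n ] term i j) (λ i → ∑[ j < n ] term j i) ⟩
    ∑[ i < n ] ∑[ j < n ] term i j + ∑[ i < n ] ∑[ j < n ] term j i
      ≡⟨ cong (∑[ i < n ] ∑[ j < n ] term i j +_) (∑-comm (λ i j → term j i)) ⟩
    ∑[ i < n ] ∑[ j < n ] term i j + ∑[ j < n ] ∑[ i < n ] term j i
      ≡⟨ cong₂ _+_ (sumOver-transpositions H) (sumOver-transpositions H) ⟨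
    ∑[ t ∈ transpositions n ] H t + ∑[ t ∈ transpositions n ] H t ∎
    where
    open ≡-Reasoning
    term : Fin n → Fin n → ℚ
    term i j = [ i <? j ]· H (i , j)
    split : ∀ i j → [ ¬? (i ≟ j) ]· H (i , j) ≡ term i j + term j i
    split i j with <-cmp i j
    ... | tri< i<j i≢j _ = begin
      [ ¬? (i ≟ j) ]· H (i , j)  ≡⟨ []·-yes (¬? (i ≟ j)) i≢j ⟩
      H (i , j)                  ≡⟨ +-identityʳ _ ⟨
      H (i , j) + 0ℚ             ≡⟨ cong₂ _+_ ([]·-yes (i <? j) i<j) ([]·-no (j <? i) (<-asym i<j)) ⟨
      term i j + term j i        ∎
    ... | tri≈ i≮i refl _ = begin
      [ ¬? (i ≟ i) ]· H (i , i)  ≡⟨ []·-no (¬? (i ≟ i)) (λ i≢i → i≢i refl) ⟩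
      0ℚ                         ≡⟨ cong₂ _+_ ([]·-no (i <? i) i≮i) ([]·-no (i <? i) i≮i) ⟨
      term i i + term i i        ∎
    ... | tri> _ i≢j j<i = begin
      [ ¬? (i ≟ j) ]· H (i , j)  ≡⟨ []·-yes (¬? (i ≟ j)) i≢j ⟩
      H (i , j)                  ≡⟨ H-sym i j ⟩
      H (j , i)                  ≡⟨ +-identityˡ _ ⟨
      0ℚ + H (j , i)             ≡⟨ cong₂ _+_ ([]·-no (i <? j) (<-asym j<i)) ([]·-yes (j <? i) j<i) ⟨
      term i j + term j i        ∎

  -- Both sides are half the sum of H over the ordered pairs i ≢ j, and relabelling by the
  -- involution swap a b leaves that sum unchanged.
  sumOver-transpositions-conj : (a b : Fin n) (H : Fin n × Fin n → ℚ) → (∀ i j → H (i , j) ≡ H (j , i)) →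
    ∑[ t ∈ transpositions n ] H (conj (a , b) t) ≡ ∑[ t ∈ transpositions n ] H t
  sumOver-transpositions-conj a b H H-sym = double-injective (begin
    ∑[ t ∈ transpositions n ] H (conj (a , b) t) + ∑[ t ∈ transpositions n ] H (conj (a , b) t)
      ≡⟨ sumOver-transpositions-offDiagonal (H ∘ conj (a , b)) (λ i j → H-sym (σ i) (σ j)) ⟨
    ∑[ i < n ] ∑[ j < n ] [ ¬? (i ≟ j) ]· H (σ i , σ j)
      ≡⟨ sum-cong-≗ (λ i → sum-cong-≗ (λ j → []·-⇔ (¬? (i ≟ j)) (¬? (σ i ≟ σ j))
           (λ i≢j → i≢j ∘ swap-injective a b) (λ σi≢σj → σi≢σj ∘ cong σ))) ⟩
    ∑[ i < n ] ∑[ j < n ] offDiagonal (σ i) (σ j)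
      ≡⟨ sum-cong-≗ (λ i → ∑-involution σ (swap-involutive a b) (offDiagonal (σ i))) ⟩
    ∑[ i < n ] ∑[ j < n ] offDiagonal (σ i) j
      ≡⟨ ∑-involution σ (swap-involutive a b) (λ i → ∑[ j < n ] offDiagonal i j) ⟩
    ∑[ i < n ] ∑[ j < n ] offDiagonal i j
      ≡⟨ sumOver-transpositions-offDiagonal H H-sym ⟩
    ∑[ t ∈ transpositions n ] H t + ∑[ t ∈ transpositions n ] H t ∎)
    where
    open ≡-Reasoning
    σ : Fin n → Fin n
    σ = swap a b
    offDiagonal : Fin n → Fin n → ℚ
    offDiagonal i j = [ ¬? (i ≟ j) ]· H (i , j)
    double-injective : ∀ {p q} → p + p ≡ q + q → p ≡ q
    double-injective {p} {q} p+p≡q+q = begin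
      p              ≡⟨ solve 1 (λ p → p := con ½ :* (p :+ p)) refl p ⟩
      ½ * (p + p)    ≡⟨ cong (½ *_) p+p≡q+q ⟩
      ½ * (q + q)    ≡⟨ solve 1 (λ q → con ½ :* (q :+ q) := q) refl q ⟩
      q              ∎

  sumOver-transpositions-conj-· : (s : Fin n × Fin n) (y : Perm n) (h : Perm n → ℚ) →
    ∑[ t ∈ transpositions n ] h (conj s t · y) ≡ ∑[ t ∈ transpositions n ] h (t · y)
  sumOver-transpositions-conj-· (a , b) y h =
    sumOver-transpositions-conj a b (λ t → h (t · y)) (λ i j → cong h (·-comm i j y))

module TranspositionCurvature (n : ℕ) = ConjugationInvariant
  (CayleyTrans n) (transpositions n) _·_ nbrs-CayleyTrans ·-involutive conj ·-conj sumOver-transpositions-conj-·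

-- The extremal function

module CappedDistance (n : ℕ) where

  open TranspositionCurvature n

  infix 4 _∈supp_

  _∈supp_ : Fin n → Perm n → Set
  k ∈supp y = ⟦ y ⟧ k ≢ k

  ∈supp-intro : ∀ y {k l} → ⟦ y ⟧ k ≡ l → l ≢ k → k ∈supp y
  ∈supp-intro _ yk≡l l≢k yk≡k = l≢k (trans (sym yk≡l) yk≡k)

  SuppNonEmpty : Perm n → Set
  SuppNonEmpty y = ∃[ k ] k ∈supp y

  SuppHasThree : Perm n → Set
  SuppHasThree y = ∃[ k ] ∃[ l ] ∃[ m ] (k ≢ l × k ≢ m × l ≢ m) × (k ∈supp y × l ∈supp y × m ∈supp y)

  _∈supp?_ : ∀ k y → Dec (k ∈supp y)
  k ∈supp? y = ¬? (⟦ y ⟧ k ≟ k)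

  suppNonEmpty? : ∀ y → Dec (SuppNonEmpty y)
  suppNonEmpty? y = any? (_∈supp? y)

  suppHasThree? : ∀ y → Dec (SuppHasThree y)
  suppHasThree? y = any? λ k → any? λ l → any? λ m →
    (¬? (k ≟ l) ×-dec ¬? (k ≟ m) ×-dec ¬? (l ≟ m)) ×-dec (k ∈supp? y ×-dec l ∈supp? y ×-dec m ∈supp? y)

  -- d₂ y = min(2, d(ι, y)), since a permutation at distance ≥ 2 from ι moves at least three points.
  d₂ : Perm n → ℚ
  d₂ y = [ suppNonEmpty? y ]· 1ℚ + [ suppHasThree? y ]· 1ℚ

  d₂-ι : d₂ ι ≡ 0ℚ
  d₂-ι = cong₂ _+_ ([]·-no (suppNonEmpty? ι) (λ (k , k∈) → k∈ (lookup-allFin k)))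
                   ([]·-no (suppHasThree? ι) (λ (k , _ , _ , _ , (k∈ , _)) → k∈ (lookup-allFin k)))

  d₂-transposition : {i j : Fin n} → i ≢ j → d₂ ((i , j) · ι) ≡ 1ℚ
  d₂-transposition {i} {j} i≢j = trans
    (cong₂ _+_ ([]·-yes (suppNonEmpty? τ) (i , ∈supp-intro τ (⟦τ⟧ i) (swap-movesˡ i≢j)))
               ([]·-no (suppHasThree? τ) (λ (k , l , m , (k≢l , k≢m , l≢m) , (k∈ , l∈ , m∈)) →
                  pigeonhole k≢l k≢m l≢m (endpoint k∈) (endpoint l∈) (endpoint m∈))))
    (+-identityʳ 1ℚ)
    where
    τ : Perm n
    τ = (i , j) · ι
    ⟦τ⟧ : ∀ k → ⟦ τ ⟧ k ≡ swap i j k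
    ⟦τ⟧ k = trans (⟦·⟧ i j ι k) (cong (swap i j) (lookup-allFin k))
    endpoint : ∀ {k} → k ∈supp τ → k ≡ i ⊎ k ≡ j
    endpoint {k} k∈ = swap-moved (k∈ ∘ trans (⟦τ⟧ k))
    pigeonhole : ∀ {k l m} → k ≢ l → k ≢ m → l ≢ m →
                 k ≡ i ⊎ k ≡ j → l ≡ i ⊎ l ≡ j → m ≡ i ⊎ m ≡ j → ⊥
    pigeonhole k≢l _   _   (inj₁ refl) (inj₁ refl) _           = k≢l refl
    pigeonhole k≢l _   _   (inj₂ refl) (inj₂ refl) _           = k≢l refl
    pigeonhole _   k≢m _   (inj₁ refl) (inj₂ refl) (inj₁ refl) = k≢m refl
    pigeonhole _   _   l≢m (inj₁ refl) (inj₂ refl) (inj₂ refl) = l≢m refl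
    pigeonhole _   _   l≢m (inj₂ refl) (inj₁ refl) (inj₁ refl) = l≢m refl
    pigeonhole _   k≢m _   (inj₂ refl) (inj₁ refl) (inj₂ refl) = k≢m refl

  d₂-product : {a b i j : Fin n} → a < b → i < j → (i , j) ≢ (a , b) → d₂ ((i , j) · (a , b) · ι) ≡ 2ℚ
  d₂-product {a} {b} {i} {j} a<b i<j ij≢ab =
    cong₂ _+_ ([]·-yes (suppNonEmpty? τ) (a , a∈)) ([]·-yes (suppHasThree? τ) three)
    where
    τ : Perm n
    τ = (i , j) · (a , b) · ι
    ⟦τ⟧ : ∀ k → ⟦ τ ⟧ k ≡ swap i j (swap a b k)
    ⟦τ⟧ k = trans (⟦·⟧ i j ((a , b) · ι) k)
                  (cong (swap i j) (trans (⟦·⟧ a b ι k) (cong (swap a b) (lookup-allFin k))))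
    a↛b : swap i j a ≢ b
    a↛b swap≡b = ij≢ab (same-ends a<b i<j (swap-exchanges swap≡b (<⇒≢ a<b)))
    a∈ : a ∈supp τ
    a∈ = ∈supp-intro τ (trans (⟦τ⟧ a) (cong (swap i j) (swap-matchˡ a b)))
           (λ swap≡a → a↛b (trans (cong (swap i j) (sym swap≡a)) (swap-involutive i j b)))
    b∈ : b ∈supp τ
    b∈ = ∈supp-intro τ (trans (⟦τ⟧ b) (cong (swap i j) (swap-matchʳ a b))) a↛b
    three : SuppHasThree τ
    three with fresh-end a<b i<j ij≢ab
    ... | c , c≢a , c≢b , c-moved =
      a , b , c , (<⇒≢ a<b , c≢a ∘ sym , c≢b ∘ sym) ,
      (a∈ , b∈ , ∈supp-intro τ (trans (⟦τ⟧ c) (cong (swap i j) (swap-noMatch c≢a c≢b))) c-moved)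

  mixed-d₂-vanishes : {a b i j : Fin n} → a < b → i < j → (i , j) ≢ (a , b) →
                      mixed d₂ ι (a , b) (i , j) ≡ 0ℚ
  mixed-d₂-vanishes a<b i<j ij≢ab =
    evaluate (d₂-product a<b i<j ij≢ab) (d₂-transposition (<⇒≢ a<b))
             (d₂-transposition (<⇒≢ i<j ∘ swap-injective _ _)) d₂-ι
    where
    evaluate : ∀ {z y w x} → z ≡ 2ℚ → y ≡ 1ℚ → w ≡ 1ℚ → x ≡ 0ℚ → z - x - (y - x) - (w - x) ≡ 0ℚ
    evaluate refl refl refl refl = refl

  Γ₂-d₂ : Γ₂ (CayleyTrans n) d₂ ι ≡ 2ℚ * Γ (CayleyTrans n) d₂ ι
  Γ₂-d₂ = Γ₂≡2Γ d₂ ι (sumOver-transpositions-cong λ a<b →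
    sumOver-transpositions-supported (λ t → (mixed d₂ ι _ t) ²) a<b
      (λ i<j ij≢ab → cong _² (mixed-d₂-vanishes a<b i<j ij≢ab)))

  Γ-d₂-positive : {i j : Fin n} → i < j → 0ℚ ℚ.< Γ (CayleyTrans n) d₂ ι
  Γ-d₂-positive {i} {j} i<j = begin-strict
    0ℚ
      <⟨ positive⁻¹ ½ ⟩
    ½ * (0ℚ - 1ℚ) ²
      ≡⟨ cong₂ (λ p q → ½ * (p - q) ²) d₂-ι (d₂-transposition (<⇒≢ i<j)) ⟨
    ½ * (d₂ ι - d₂ ((i , j) · ι)) ²
      ≤⟨ *-monoˡ-≤-nonNeg ½ (∈⇒≤-sumOver (λ t → ²-nonNeg (d₂ ι - d₂ (t · ι)))
                                         (∈-transpositions i<j)) ⟩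
    ½ * ∑[ t ∈ transpositions n ] (d₂ ι - d₂ (t · ι)) ²
      ≡⟨ Γ-gens d₂ ι ⟨
    Γ (CayleyTrans n) d₂ ι ∎
    where open ≤-Reasoning

-- Imported only here: its prefix operator +_ would make the sections (x +_) used above ambiguous.
open import Data.Integer using (+_)

theorem12 : (n : ℕ) → 2 ≤ n → RicIs (CayleyTrans n) ((+ 2) / 1)
theorem12 n@(suc (suc _)) (s≤s (s≤s z≤n)) =
  RicIs-attained (CayleyTrans n) curvature≥2 d₂ ι Γ₂-d₂ (Γ-d₂-positive {zero} {suc zero} (s≤s z≤n))
  where
  open TranspositionCurvature n using (curvature≥2)
  open CappedDistance n using (d₂; Γ₂-d₂; Γ-d₂-positive)
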